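{- Let $\langle \pi, \equiv_\pi \rangle$ be an abstract semantics that is branching, discharging and strong smn, and let $n\geq 1$. If $A\subseteq\mathbb{N}$ is partially $\sim_\pi^n$-extensional and not universally $\sim_\pi^n$-extensional, then $A$ is not recursive.
   Context: Fix a Turing-complete programming model with a Gödel numbering of its programs; $\phi_a^{(n)}:\mathbb{N}^n\rightharpoonup\mathbb{N}$ denotes the $n$-ary partial function computed by the $a$-th program ($\phi_a=\phi_a^{(1)}$), and every partial recursive function equals some $\phi_a^{(n)}$. Let $\mathcal{F}$ denote the class of all partial functions $\mathbb{N}^n\rightharpoonup\mathbb{N}$, $n\in\mathbb{N}$. An abstract semantics is a pair $\langle\pi,\equiv_\pi\rangle$ where $\pi$ assigns to each index $a$ and arity $n$ a partial function $\pi_a^{(n)}:\mathbb{N}^n\rightharpoonup\mathbb{N}$ and $\equiv_\pi$ is an equivalence relation on $\mathcal{F}$; $a\sim_\pi^n b$ iff $\pi_a^{(n)}\equiv_\pi\pi_b^{(n)}$. Strong smn: for all $m,n\ge1$ there is a total computable $s:\mathbb{N}^{m+2}\to\mathbb{N}$ with $\lambda\vec y.\,\pi_a^{(n+1)}(\phi_b^{(m)}(\vec x),\vec y)\equiv_\pi\pi_{s(a,b,\vec x)}^{(n)}$ for all $a,b,\vec x$. Branching: for every $n\ge1$ there is a total computable $r:\mathbb{N}^4\to\mathbb{N}$ such that for all $a,b,c_1,c_2,x\in\mathbb{N}$ with $c_1\neq c_2$: $\lambda\vec y.\,\pi^{(n)}_{r(a,b,c_1,c_2)}(x,\vec y)\equiv_\pi\lambda\vec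 y.\,\pi_a^{(n)}(x,\vec y)$ if $x=c_1$, $\equiv_\pi\lambda\vec y.\,\pi_b^{(n)}(x,\vec y)$ if $x=c_2$, and $\equiv_\pi$ the everywhere undefined function otherwise. Discharging: for every $n\ge1$ there is a total computable $t:\mathbb{N}\to\mathbb{N}$ such that for all $a,x\in\mathbb{N}$: $\pi_a^{(n)}\equiv_\pi\lambda\vec y.\,\pi_{t(a)}^{(n+1)}(x,\vec y)$. For an equivalence $\sim$ on $\mathbb{N}$, $A\subseteq\mathbb{N}$ is partially $\sim$-extensional if $[a]_\sim\subseteq A$ for some $a$, and universally $\sim$-extensional if $[a]_\sim\cap A\ne\varnothing$ for all $a$. -}

module Defs where

open import Level using (Level; 0ℓ)
open import Data.Nat using (ℕ; zero; suc; _+_; _<_; _≤_)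
open import Data.Fin using (Fin)
open import Data.Vec using (Vec; []; _∷_; lookup; _++_)
open import Data.Product using (Σ; _×_; _,_; ∃-syntax)
open import Data.Empty using (⊥)
open import Relation.Nullary using (¬_)
open import Relation.Binary.PropositionalEquality using (_≡_; _≢_)
open import Relation.Binary.Structures using (IsEquivalence)
open import Function.Bundles using (_⇔_)

data Code : ℕ → Set where
  zer  : ∀ {n} → Code n
  sc   : Code 1
  proj : ∀ {n} → Fin n → Code n
  comp : ∀ {m n} → Code m → Vec (Code n) m → Code n
  prec : ∀ {n} → Code n → Code (suc (suc n)) → Code (suc n)
  mu   : ∀ {n} → Code (suc n) → Code n

data Eval : ∀ {n} → Code n → Vec ℕ n → ℕ → Set
data EvalAll : ∀ {m n} → Vec (Code n) m → Vec ℕ n → Vec ℕ m → Set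

data Eval where
  ev-zer  : ∀ {n} {xs : Vec ℕ n} → Eval zer xs 0
  ev-sc   : ∀ {x} → Eval sc (x ∷ []) (suc x)
  ev-proj : ∀ {n} {i : Fin n} {xs} → Eval (proj i) xs (lookup xs i)
  ev-comp : ∀ {m n} {f : Code m} {gs : Vec (Code n) m} {xs ys y} →
            EvalAll gs xs ys → Eval f ys y → Eval (comp f gs) xs y
  ev-prec0 : ∀ {n} {f : Code n} {g} {xs y} →
             Eval f xs y → Eval (prec f g) (0 ∷ xs) y
  ev-precS : ∀ {n} {f : Code n} {g} {xs k z y} →
             Eval (prec f g) (k ∷ xs) z → Eval g (k ∷ z ∷ xs) y →
             Eval (prec f g) (suc k ∷ xs) y
  ev-mu : ∀ {n} {f : Code (suc n)} {xs y} →
          Eval f (y ∷ xs) 0 →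
          (∀ z → z < y → Σ ℕ λ k → Eval f (z ∷ xs) (suc k)) →
          Eval (mu f) xs y

data EvalAll where
  []  : ∀ {n} {xs : Vec ℕ n} → EvalAll [] xs []
  _∷_ : ∀ {m n} {g : Code n} {gs : Vec (Code n) m} {xs y ys} →
        Eval g xs y → EvalAll gs xs ys → EvalAll (g ∷ gs) xs (y ∷ ys)

TotalComputable : (n : ℕ) → (Vec ℕ n → ℕ) → Set
TotalComputable n f = Σ (Code n) λ c → ∀ xs → Eval c xs (f xs)

Recursive : (ℕ → Set) → Set
Recursive A = Σ (Vec ℕ 1 → ℕ) λ χ → TotalComputable 1 χ ×
  (∀ x → (A x → χ (x ∷ []) ≡ 1) × (¬ A x → χ (x ∷ []) ≡ 0))

PF : ℕ → Set₁
PF n = Vec ℕ n → ℕ → Set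

Functional : ∀ {n} → PF n → Set
Functional f = ∀ xs y z → f xs y → f xs z → y ≡ z

_≐_ : ∀ {n} → PF n → PF n → Set
f ≐ g = ∀ xs y → f xs y ⇔ g xs y

undef : ∀ {n} → PF n
undef _ _ = ⊥

𝓕 : Set₁
𝓕 = Σ ℕ PF

record GödelNumbering : Set₁ where
  field
    φ : (n : ℕ) → ℕ → PF n
    universal : ∀ n → Σ (Code (suc n)) λ u →
      ∀ a xs y → φ n a xs y ⇔ Eval u (a ∷ xs) y
    complete : ∀ n (c : Code n) → Σ ℕ λ a → φ n a ≐ Eval c
    smn : ∀ m n → Σ (Vec ℕ (suc m) → ℕ) λ s → TotalComputable (suc m) s ×
      (∀ a xs → φ n (s (a ∷ xs)) ≐ (λ ys → φ (m + n) a (xs ++ ys)))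

record AbstractSemantics : Set₁ where
  field
    π : (n : ℕ) → ℕ → PF n
    π-functional : ∀ n a → Functional (π n a)
    _≡π_ : 𝓕 → 𝓕 → Set
    ≡π-isEquivalence : IsEquivalence _≡π_
    -- ≡π is a relation on partial functions, so it cannot distinguish
    -- two graph representations of the same partial function
    ≡π-ext : ∀ {n} {f g : PF n} → f ≐ g → (n , f) ≡π (n , g)

  _∼[_]_ : ℕ → ℕ → ℕ → Set
  a ∼[ n ] b = (n , π n a) ≡π (n , π n b)

open AbstractSemantics public

module _ (G : GödelNumbering) (S : AbstractSemantics) where
  open GödelNumbering G
  open AbstractSemantics S renaming (π to πS; _≡π_ to _≈_)

  StrongSmn : Set
  StrongSmn = ∀ m n → 1 ≤ m → 1 ≤ n →
    Σ (Vec ℕ (suc (suc m)) → ℕ) λ s → TotalComputable (suc (suc m)) s ×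
      (∀ a b xs →
        (n , (λ ys v → Σ ℕ λ z → φ m b xs z × πS (suc n) a (z ∷ ys) v))
          ≈ (n , πS n (s (a ∷ b ∷ xs))))

  -- branching, for n = suc k ≥ 1; ys ranges over ℕ^(n-1)
  Branching : Set
  Branching = ∀ k →
    Σ (Vec ℕ 4 → ℕ) λ r → TotalComputable 4 r ×
      (∀ a b c₁ c₂ x → c₁ ≢ c₂ →
        let R = πS (suc k) (r (a ∷ b ∷ c₁ ∷ c₂ ∷ [])) in
        (x ≡ c₁ → (k , λ ys → R (x ∷ ys)) ≈ (k , λ ys → πS (suc k) a (x ∷ ys))) ×
        (x ≡ c₂ → (k , λ ys → R (x ∷ ys)) ≈ (k , λ ys → πS (suc k) b (x ∷ ys))) ×
        (x ≢ c₁ → x ≢ c₂ → (k , λ ys → R (x ∷ ys)) ≈ (k , undef)))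

  Discharging : Set
  Discharging = ∀ n → 1 ≤ n →
    Σ (Vec ℕ 1 → ℕ) λ t → TotalComputable 1 t ×
      (∀ a x → (n , πS n a) ≈ (n , λ ys → πS (suc n) (t (a ∷ [])) (x ∷ ys)))

PartiallyExtensional : (ℕ → ℕ → Set) → (ℕ → Set) → Set
PartiallyExtensional _∼_ A = Σ ℕ λ a → ∀ b → a ∼ b → A b

UniversallyExtensional : (ℕ → ℕ → Set) → (ℕ → Set) → Set
UniversallyExtensional _∼_ A = ∀ a → Σ ℕ λ b → a ∼ b × A b

-- "not universally extensional", in its positive form:
-- some class [a]_∼ is disjoint from A
NotUniversallyExtensional : (ℕ → ℕ → Set) → (ℕ → Set) → Set
NotUniversallyExtensional _∼_ A = Σ ℕ λ a → ∀ b → a ∼ b → ¬ A b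

-- A Rice-type argument through a self-referential program.  Take a ∈ A with
-- [a] ⊆ A and b with [b] disjoint from A, and let c branch on its first
-- argument: c behaves like a on 0 and like b on 1.  If χ decided A, the
-- recursion theorem (from smn for φ and strong smn for π) would give an e with
-- π_e ≈ π_c(χ(e), ·).  Then e ∈ A forces χ(e) = 1, so e ∼ b and e ∉ A, while
-- e ∉ A forces χ(e) = 0, so e ∼ a and e ∈ A.
module Submission where

open import Defs
open import Data.Nat using (ℕ; zero; suc; _≤_)
open import Data.Nat.Properties using (<-cmp; ≤-refl; 0≢1+n)
open import Data.Fin using () renaming (zero to fzero)
open import Data.Vec using (Vec; []; _∷_)
open import Data.Product using (Σ; _×_; _,_; proj₁; proj₂)
open import Data.Empty using (⊥-elim)
open import Relation.Nullary using (¬_)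
open import Relation.Binary.PropositionalEquality using (_≡_; refl; sym; subst)
open import Relation.Binary.Definitions using (tri<; tri≈; tri>)
open import Relation.Binary.Structures using (IsEquivalence)
open import Function.Bundles using (mk⇔; Equivalence)

Eval-deterministic : ∀ {n} {c : Code n} {xs y z} → Eval c xs y → Eval c xs z → y ≡ z
EvalAll-deterministic : ∀ {m n} {gs : Vec (Code n) m} {xs ys zs} →
  EvalAll gs xs ys → EvalAll gs xs zs → ys ≡ zs

Eval-deterministic ev-zer ev-zer = refl
Eval-deterministic ev-sc ev-sc = refl
Eval-deterministic ev-proj ev-proj = refl
Eval-deterministic (ev-comp gs₁ f₁) (ev-comp gs₂ f₂)
  with EvalAll-deterministic gs₁ gs₂
... | refl = Eval-deterministic f₁ f₂
Eval-deterministic (ev-prec0 f₁) (ev-prec0 f₂) = Eval-deterministic f₁ f₂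
Eval-deterministic (ev-precS p₁ g₁) (ev-precS p₂ g₂)
  with Eval-deterministic p₁ p₂
... | refl = Eval-deterministic g₁ g₂
Eval-deterministic (ev-mu {y = y₁} f₁ below₁) (ev-mu {y = y₂} f₂ below₂)
  with <-cmp y₁ y₂
... | tri< y₁<y₂ _ _ = ⊥-elim (0≢1+n (Eval-deterministic f₁ (proj₂ (below₂ y₁ y₁<y₂))))
... | tri≈ _ y₁≡y₂ _ = y₁≡y₂
... | tri> _ _ y₂<y₁ = ⊥-elim (0≢1+n (sym (Eval-deterministic (proj₂ (below₁ y₂ y₂<y₁)) f₂)))

EvalAll-deterministic [] [] = refl
EvalAll-deterministic (g₁ ∷ gs₁) (g₂ ∷ gs₂)
  with Eval-deterministic g₁ g₂ | EvalAll-deterministic gs₁ gs₂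
... | refl | refl = refl

const-code : ∀ {n} → ℕ → Code n
const-code zero = zer
const-code (suc k) = comp sc (const-code k ∷ [])

Eval-const-code : ∀ {n} k {xs : Vec ℕ n} → Eval (const-code k) xs k
Eval-const-code zero = ev-zer
Eval-const-code (suc k) = ev-comp (Eval-const-code k ∷ []) ev-sc

module _ (G : GödelNumbering) (S : AbstractSemantics) where
  open GödelNumbering G
  open AbstractSemantics S using () renaming (π to πS; _≡π_ to _≈_)
  open IsEquivalence (≡π-isEquivalence S) using () renaming (sym to ≈-sym; trans to ≈-trans)

  recursion-theorem : StrongSmn G S → ∀ n → 1 ≤ n →
    (h : Vec ℕ 1 → ℕ) → TotalComputable 1 h → ∀ c →
    Σ ℕ λ e → (n , πS n e) ≈ (n , λ ys → πS (suc n) c (h (e ∷ []) ∷ ys))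
  recursion-theorem strong-smn n 1≤n h (h-code , h-spec) c
    with strong-smn 1 n ≤-refl 1≤n
  ... | s , (s-code , s-spec) , s-smn =
    e , ≈-trans (≈-sym (s-smn c b (b ∷ []))) (≡π-ext S unfold-diagonal)
    where
    -- φ_b(x) = h(s(c, x, x)), so at e = s(c, b, b) the program b computes h(e).
    diagonal : Code 1
    diagonal = comp h-code (comp s-code (const-code c ∷ proj fzero ∷ proj fzero ∷ []) ∷ [])

    Eval-diagonal : ∀ x → Eval diagonal (x ∷ []) (h (s (c ∷ x ∷ x ∷ []) ∷ []))
    Eval-diagonal x =
      ev-comp (ev-comp (Eval-const-code c ∷ ev-proj ∷ ev-proj ∷ []) (s-spec _) ∷ []) (h-spec _)

    b : ℕ
    b = proj₁ (complete 1 diagonal)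

    φb≐diagonal : φ 1 b ≐ Eval diagonal
    φb≐diagonal = proj₂ (complete 1 diagonal)

    e : ℕ
    e = s (c ∷ b ∷ b ∷ [])

    unfold-diagonal : (λ ys v → Σ ℕ λ z → φ 1 b (b ∷ []) z × πS (suc n) c (z ∷ ys) v)
                    ≐ (λ ys → πS (suc n) c (h (e ∷ []) ∷ ys))
    unfold-diagonal ys v = mk⇔
      (λ { (z , φb-b≡z , πc) →
             subst (λ u → πS (suc n) c (u ∷ ys) v)
               (Eval-deterministic (Equivalence.to (φb≐diagonal (b ∷ []) z) φb-b≡z) (Eval-diagonal b))
               πc })
      (λ πc → h (e ∷ []) , Equivalence.from (φb≐diagonal (b ∷ []) _) (Eval-diagonal b) , πc)

  branch-on-0-1 : Branching G S → Discharging G S → ∀ n → 1 ≤ n → ∀ a b →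
    Σ ℕ λ c → ((n , λ ys → πS (suc n) c (0 ∷ ys)) ≈ (n , πS n a))
            × ((n , λ ys → πS (suc n) c (1 ∷ ys)) ≈ (n , πS n b))
  branch-on-0-1 branching discharging n 1≤n a b
    with branching n | discharging n 1≤n
  ... | r , _ , r-spec | t , _ , t-spec =
    r (ta ∷ tb ∷ 0 ∷ 1 ∷ []) ,
    ≈-trans (proj₁ (r-spec ta tb 0 1 0 0≢1+n) refl) (≈-sym (t-spec a 0)) ,
    ≈-trans (proj₁ (proj₂ (r-spec ta tb 0 1 1 0≢1+n)) refl) (≈-sym (t-spec b 1))
    where
    ta tb : ℕ
    ta = t (a ∷ [])
    tb = t (b ∷ [])

mainTheorem3 : (G : GödelNumbering) (S : AbstractSemantics) →
    Branching G S → Discharging G S → StrongSmn G S →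
    (n : ℕ) → 1 ≤ n → (A : ℕ → Set) →
    PartiallyExtensional (λ a b → _∼[_]_ S a n b) A →
    NotUniversallyExtensional (λ a b → _∼[_]_ S a n b) A →
    ¬ Recursive A
mainTheorem3 G S branching discharging strong-smn n 1≤n A
  (a , [a]⊆A) (b , [b]∩A≡∅) (χ , χ-computable , χ-decides)
  with branch-on-0-1 G S branching discharging n 1≤n a b
... | c , c₀≈a , c₁≈b
  with recursion-theorem G S strong-smn n 1≤n χ χ-computable c
... | e , e≈cχe = e∉A e∈A
  where
  open AbstractSemantics S using () renaming (π to πS; _≡π_ to _≈_)
  open IsEquivalence (≡π-isEquivalence S) using () renaming (sym to ≈-sym; trans to ≈-trans)

  e≈c : ∀ {i} → χ (e ∷ []) ≡ i → (n , πS n e) ≈ (n , λ ys → πS (suc n) c (i ∷ ys))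
  e≈c χe≡i = subst (λ i → (n , πS n e) ≈ (n , λ ys → πS (suc n) c (i ∷ ys))) χe≡i e≈cχe

  e∉A : ¬ A e
  e∉A e∈A = [b]∩A≡∅ e (≈-sym (≈-trans (e≈c (proj₁ (χ-decides e) e∈A)) c₁≈b)) e∈A

  e∈A : A e
  e∈A = [a]⊆A e (≈-sym (≈-trans (e≈c (proj₂ (χ-decides e) e∉A)) c₀≈a))
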